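{- In any execution of Algorithm 1 (described in the context), at some point every node has sent and received exactly $\mathrm{ID}_{\max}$ pulses, and the network is in quiescence.
   Context: Oriented ring of $n$ nodes, content-oblivious asynchronous model (content-free pulses, delivered after arbitrary finite delays, never lost or injected; each node has an incoming queue per port). Each node $v$ has a unique positive integer ID $\mathrm{ID}(v)$; $\mathrm{ID}_{\max}=\max_v\mathrm{ID}(v)$. $\rho_{cw}(v)$ and $\sigma_{cw}(v)$ are the numbers of clockwise (CW) pulses node $v$ has received (consumed from its queue) and sent, initially 0. Algorithm 1 at node $v$: first send one CW pulse; then loop forever: if a CW pulse is waiting, consume it (incrementing $\rho_{cw}(v)$); then if $\rho_{cw}(v)=\mathrm{ID}(v)$ set state to Leader and send nothing, otherwise set state to Non-Leader and send one CW pulse. Quiescence: no pulses in transit (every sent pulse has been consumed). -}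

module Defs where

open import Data.Nat using (ℕ; zero; suc; _+_; _∸_; _⊔_; _≤_; _<_)
open import Data.Nat.DivMod using (_mod_)
open import Data.Fin using (Fin; toℕ; _≟_)
open import Data.List using (foldr; allFin)
open import Data.Bool using (Bool; true; false; if_then_else_)
open import Data.Product using (∃; _×_)
open import Relation.Nullary using (yes; no)
open import Relation.Nullary.Decidable using (⌊_⌋)
open import Relation.Binary.PropositionalEquality using (_≡_)
open import Data.Nat using () renaming (_≟_ to _≟ℕ_)

-- Oriented ring with nodes Fin n; node i sends its CW pulses to node cwNext i.
cwNext : ∀ {n} → Fin n → Fin n
cwNext {suc m} i = suc (toℕ i) mod suc m

idMax : ∀ {n} → (Fin n → ℕ) → ℕ
idMax {n} ID = foldr (λ i acc → ID i ⊔ acc) 0 (allFin n)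

-- Global configuration of an execution of Algorithm 1.
--   started i : node i has already sent its initial CW pulse
--   rho i     : ρ_cw(i), CW pulses consumed by i
--   sigma i   : σ_cw(i), CW pulses sent by i
--   inbox i   : CW pulses sent to i (by its CCW neighbour) and not yet
--               consumed by i (in transit or waiting in i's queue)
record Config (n : ℕ) : Set where
  constructor config
  field
    started : Fin n → Bool
    rho     : Fin n → ℕ
    sigma   : Fin n → ℕ
    inbox   : Fin n → ℕ
open Config public

initial : ∀ {n} → Config n
initial = config (λ _ → false) (λ _ → 0) (λ _ → 0) (λ _ → 0)

bump : ∀ {n} → Fin n → ℕ → (Fin n → ℕ) → (Fin n → ℕ)
bump i k f j = if ⌊ i ≟ j ⌋ then f j + k else f j

drop1 : ∀ {n} → Fin n → (Fin n → ℕ) → (Fin n → ℕ)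
drop1 i f j = if ⌊ i ≟ j ⌋ then f j ∸ 1 else f j

sendCW : ∀ {n} → Fin n → Config n → Config n
sendCW i c = config (started c) (rho c) (bump i 1 (sigma c)) (bump (cwNext i) 1 (inbox c))

step : ∀ {n} → (Fin n → ℕ) → Fin n → Config n → Config n
step ID i c with started c i
... | false = sendCW i (config (λ j → if ⌊ i ≟ j ⌋ then true else started c j)
                               (rho c) (sigma c) (inbox c))
... | true with inbox c i
...   | zero = c
...   | suc _ =
  let c' = config (started c) (bump i 1 (rho c)) (sigma c) (drop1 i (inbox c)) in
  if ⌊ rho c' i ≟ℕ ID i ⌋ then c' else sendCW i c'

-- Arbitrary finite delays are modelled by the
-- arbitrary interleaving; fairness guarantees every node acts infinitely often.
run : ∀ {n} → (Fin n → ℕ) → (ℕ → Fin n) → ℕ → Config n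
run ID s zero    = initial
run ID s (suc t) = step ID (s t) (run ID s t)

Fair : ∀ {n} → (ℕ → Fin n) → Set
Fair {n} s = ∀ (i : Fin n) (t : ℕ) → ∃ λ t' → t ≤ t' × s t' ≡ i

Quiescent : ∀ {n} → Config n → Set
Quiescent {n} c = ∀ (i : Fin n) → inbox c i ≡ 0

module Submission where

open import Defs
open import Data.Bool using (Bool; true; false; if_then_else_) renaming (_≟_ to _≟ᵇ_)
open import Data.Empty using (⊥-elim)
open import Data.Fin using (Fin; zero; suc; toℕ; fromℕ; inject₁; _≟_)
open import Data.Fin.Induction using (<-weakInduction; >-weakInduction)
open import Data.Fin.Properties using (toℕ-injective; toℕ-fromℕ; toℕ-fromℕ<; toℕ-inject₁; toℕ<n; all?; ¬∀⟶∃¬)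
open import Data.Fin.Relation.Unary.Top using (view; ‵fromℕ; ‵inject₁)
open import Data.List using ([]; _∷_; foldr; allFin)
open import Data.List.Membership.Propositional using (_∈_)
open import Data.List.Membership.Propositional.Properties using (∈-allFin)
open import Data.List.Relation.Unary.Any using (here; there)
open import Data.Nat using (ℕ; zero; suc; _+_; _∸_; _⊔_; _≤_; _<_; z≤n; s≤s; s≤s⁻¹; _≤?_) renaming (_≟_ to _≟ℕ_)
open import Data.Nat.DivMod using (_%_; m<n⇒m%n≡m; n%n≡0)
open import Data.Nat.Properties hiding (_≟_)
open import Algebra.Properties.Monoid.Sum +-0-monoid using (sum; sum-cong-≗)
open import Data.Product using (∃; _×_; _,_; proj₁; proj₂)
open import Data.Sum using (_⊎_; inj₁; inj₂)
open import Function using (_∘_)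
open import Function.Definitions using (Injective)
open import Relation.Nullary using (Dec; yes; no; ¬_)
open import Relation.Nullary.Decidable using (⌊_⌋; _×-dec_)
open import Relation.Binary.PropositionalEquality

-- Three invariants hold throughout any execution: at each node
-- σ + [ρ ≥ ID] = [started] + ρ (every consumed pulse is relayed, except the ID-th,
-- which the node swallows when it becomes Leader), on each link the pulses received
-- plus those in transit equal those sent, and ρ ≤ ID_max.  Every step that changes
-- the configuration is one new event (start or consumption) at one node, and there
-- are at most n (ID_max + 1) events, so by fairness all nodes eventually have started
-- and have empty queues.  Then ρ cannot decrease along the ring, so it is a constant R;
-- hence σ = R everywhere, the invariant at each node forces ID ≤ R, and R = ID_max.

-- The ring

toℕ-cwNext : ∀ {m} (i : Fin (suc m)) → toℕ (cwNext i) ≡ suc (toℕ i) % suc m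
toℕ-cwNext i = toℕ-fromℕ< _

cwNext-inject₁ : ∀ {m} (i : Fin m) → cwNext (inject₁ i) ≡ suc i
cwNext-inject₁ {m} i = toℕ-injective (begin
  toℕ (cwNext (inject₁ i))     ≡⟨ toℕ-cwNext (inject₁ i) ⟩
  suc (toℕ (inject₁ i)) % suc m ≡⟨ cong (λ x → suc x % suc m) (toℕ-inject₁ i) ⟩
  suc (toℕ i) % suc m           ≡⟨ m<n⇒m%n≡m (s≤s (toℕ<n i)) ⟩
  suc (toℕ i)                   ∎)
  where open ≡-Reasoning

cwNext-fromℕ : ∀ m → cwNext (fromℕ m) ≡ zero
cwNext-fromℕ m = toℕ-injective (begin
  toℕ (cwNext (fromℕ m))    ≡⟨ toℕ-cwNext (fromℕ m) ⟩
  suc (toℕ (fromℕ m)) % suc m ≡⟨ cong (λ x → suc x % suc m) (toℕ-fromℕ m) ⟩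
  suc m % suc m             ≡⟨ n%n≡0 (suc m) ⟩
  0                         ∎)
  where open ≡-Reasoning

cwPrev : ∀ {n} → Fin n → Fin n
cwPrev zero    = fromℕ _
cwPrev (suc i) = inject₁ i

cwNext-cwPrev : ∀ {n} (j : Fin n) → cwNext (cwPrev j) ≡ j
cwNext-cwPrev zero    = cwNext-fromℕ _
cwNext-cwPrev (suc i) = cwNext-inject₁ i

cwPrev-cwNext : ∀ {n} (i : Fin n) → cwPrev (cwNext i) ≡ i
cwPrev-cwNext {suc m} i with view i
... | ‵fromℕ     = cong cwPrev (cwNext-fromℕ m)
... | ‵inject₁ j = cong cwPrev (cwNext-inject₁ j)

cwNext-injective : ∀ {n} → Injective _≡_ _≡_ (cwNext {n})
cwNext-injective {x = i} {j} eq =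
  trans (sym (cwPrev-cwNext i)) (trans (cong cwPrev eq) (cwPrev-cwNext j))

cwNext-monotone⇒constant : ∀ {m} (f : Fin (suc m) → ℕ) →
  (∀ k → f k ≤ f (cwNext k)) → ∀ i → f i ≡ f zero
cwNext-monotone⇒constant {m} f mono i =
  ≤-antisym (≤-trans (≤-top i) (along (cwNext-fromℕ m))) (zero≤ i)
  where
  along : ∀ {k j} → cwNext k ≡ j → f k ≤ f j
  along {k} refl = mono k

  zero≤ : ∀ i → f zero ≤ f i
  zero≤ = <-weakInduction (λ i → f zero ≤ f i) ≤-refl
    (λ j h → ≤-trans h (along (cwNext-inject₁ j)))

  ≤-top : ∀ i → f i ≤ f (fromℕ m)
  ≤-top = >-weakInduction (λ i → f i ≤ f (fromℕ m)) ≤-refl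
    (λ j h → ≤-trans (along (cwNext-inject₁ j)) h)

if-≟-refl : ∀ {n} {A : Set} (i : Fin n) {x y : A} → (if ⌊ i ≟ i ⌋ then x else y) ≡ x
if-≟-refl i with i ≟ i
... | yes _  = refl
... | no i≢i = ⊥-elim (i≢i refl)

if-≟-≢ : ∀ {n} {A : Set} {i j : Fin n} {x y : A} → i ≢ j → (if ⌊ i ≟ j ⌋ then x else y) ≡ y
if-≟-≢ {i = i} {j} i≢j with i ≟ j
... | yes i≡j = ⊥-elim (i≢j i≡j)
... | no _    = refl

bump-updates : ∀ {n} (i : Fin n) k f → bump i k f i ≡ f i + k
bump-updates i k f = if-≟-refl i

bump-minimal : ∀ {n} {i j : Fin n} k f → i ≢ j → bump i k f j ≡ f j
bump-minimal k f = if-≟-≢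

idMax-upper : ∀ {n} (ID : Fin n → ℕ) i → ID i ≤ idMax ID
idMax-upper {n} ID i = go (allFin n) (∈-allFin i)
  where
  go : ∀ xs → i ∈ xs → ID i ≤ foldr (λ j acc → ID j ⊔ acc) 0 xs
  go (x ∷ xs) (here refl) = m≤m⊔n (ID x) _
  go (x ∷ xs) (there i∈xs) = ≤-trans (go xs i∈xs) (m≤n⊔m (ID x) _)

idMax-least : ∀ {n} (ID : Fin n → ℕ) {M} → (∀ i → ID i ≤ M) → idMax ID ≤ M
idMax-least {n} ID ID≤M = go (allFin n)
  where
  go : ∀ xs → foldr (λ j acc → ID j ⊔ acc) 0 xs ≤ _
  go []       = z≤n
  go (x ∷ xs) = ⊔-lub (ID≤M x) (go xs)

sum-mono-≤ : ∀ {n} {f g : Fin n → ℕ} → (∀ i → f i ≤ g i) → sum f ≤ sum g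
sum-mono-≤ {zero}  f≤g = z≤n
sum-mono-≤ {suc n} f≤g = +-mono-≤ (f≤g zero) (sum-mono-≤ (λ i → f≤g (suc i)))

sum-suc-at : ∀ {n} (f g : Fin n → ℕ) i → g i ≡ suc (f i) →
  (∀ j → i ≢ j → g j ≡ f j) → sum g ≡ suc (sum f)
sum-suc-at f g zero gi same =
  cong₂ _+_ gi (sum-cong-≗ (λ j → same (suc j) (λ ())))
sum-suc-at f g (suc i) gi same = begin
  g zero + sum (λ j → g (suc j))       ≡⟨ cong₂ _+_ (same zero (λ ())) (sum-suc-at _ _ i gi same-suc) ⟩
  f zero + suc (sum (λ j → f (suc j))) ≡⟨ +-suc (f zero) _ ⟩
  suc (sum f)                          ∎
  where
  open ≡-Reasoning
  same-suc : ∀ j → i ≢ j → g (suc j) ≡ f (suc j)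
  same-suc j i≢j = same (suc j) (λ { refl → i≢j refl })

fromBool : Bool → ℕ
fromBool false = 0
fromBool true  = 1

fromBool≤1 : ∀ b → fromBool b ≤ 1
fromBool≤1 false = z≤n
fromBool≤1 true  = s≤s z≤n

fromBool+n≤1+n : ∀ b n → fromBool b + n ≤ suc n
fromBool+n≤1+n b n = +-monoˡ-≤ n (fromBool≤1 b)

swallowed : ℕ → ℕ → ℕ
swallowed d r = if ⌊ d ≤? r ⌋ then 1 else 0

swallowed-< : ∀ {d r} → r < d → swallowed d r ≡ 0
swallowed-< {d} {r} r<d with d ≤? r
... | yes d≤r = ⊥-elim (<⇒≱ r<d d≤r)
... | no _    = refl

swallowed-≥ : ∀ {d r} → d ≤ r → swallowed d r ≡ 1
swallowed-≥ {d} {r} d≤r with d ≤? r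
... | yes _   = refl
... | no d≰r  = ⊥-elim (d≰r d≤r)

swallowed≤1 : ∀ d r → swallowed d r ≤ 1
swallowed≤1 d r with d ≤? r
... | yes _ = s≤s z≤n
... | no _  = z≤n

swallowed≡1⇒≤ : ∀ {d r} → swallowed d r ≡ 1 → d ≤ r
swallowed≡1⇒≤ {d} {r} eq with d ≤? r
... | yes d≤r = d≤r

swallowed-+1 : ∀ {d r} → r + 1 ≢ d → swallowed d (r + 1) ≡ swallowed d r
swallowed-+1 {d} {r} r+1≢d with d ≤? r
... | yes d≤r = swallowed-≥ (≤-trans d≤r (m≤m+n r 1))
... | no d≰r  = swallowed-< (≤∧≢⇒< (subst (_≤ d) (+-comm 1 r) (≰⇒> d≰r)) r+1≢d)

Local : Set
Local = Bool × ℕ × ℕ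

local : ∀ {n} → Config n → Fin n → Local
local c i = started c i , rho c i , sigma c i

events : Local → ℕ
events (b , r , _) = fromBool b + r

Relays : ℕ → Local → Set
Relays d l@(_ , r , s) = s + swallowed d r ≡ events l

data LocalStep (d : ℕ) : Local → Local → Set where
  start : ∀ {r s} → LocalStep d (false , r , s) (true , r , s + 1)
  elect : ∀ {r s} → r + 1 ≡ d → LocalStep d (true , r , s) (true , r + 1 , s)
  relay : ∀ {r s} → r + 1 ≢ d → LocalStep d (true , r , s) (true , r + 1 , s + 1)

events-step : ∀ {d l l'} → LocalStep d l l' → events l' ≡ suc (events l)
events-step start             = refl
events-step (elect {r = r} _) = cong suc (+-comm r 1)
events-step (relay {r = r} _) = cong suc (+-comm r 1)

m+1+n≡1+m+n : ∀ m n → m + 1 + n ≡ suc (m + n)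
m+1+n≡1+m+n m n = trans (+-assoc m 1 n) (+-suc m n)

relays-step : ∀ {d l l'} → LocalStep d l l' → Relays d l → Relays d l'
relays-step (start {r} {s}) law = trans (m+1+n≡1+m+n s _) (cong suc law)
relays-step {d} (elect {r} {s} r+1≡d) law = begin
  s + swallowed d (r + 1) ≡⟨ cong (s +_) (swallowed-≥ (≤-reflexive (sym r+1≡d))) ⟩
  s + 1                   ≡⟨ cong (_+ 1) s≡1+r ⟩
  suc (r + 1)             ∎
  where
  open ≡-Reasoning
  r<d : r < d
  r<d = subst (r <_) r+1≡d (m<m+n r (s≤s z≤n))
  s≡1+r : s ≡ suc r
  s≡1+r = trans (sym (+-identityʳ s)) (trans (cong (s +_) (sym (swallowed-< r<d))) law)
relays-step {d} (relay {r} {s} r+1≢d) law = begin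
  s + 1 + swallowed d (r + 1) ≡⟨ cong (s + 1 +_) (swallowed-+1 r+1≢d) ⟩
  s + 1 + swallowed d r       ≡⟨ m+1+n≡1+m+n s _ ⟩
  suc (s + swallowed d r)     ≡⟨ cong suc law ⟩
  suc (suc r)                 ≡⟨ cong suc (+-comm 1 r) ⟩
  suc (r + 1)                 ∎
  where open ≡-Reasoning

sent≤received⊔id : ∀ {d b r s} → Relays d (b , r , s) → s ≤ r ⊔ d
sent≤received⊔id {d} {b} {r} {s} law with ≤-<-connex d r
... | inj₁ d≤r = m≤n⇒m≤n⊔o d (s≤s⁻¹ (begin
  suc s             ≡⟨ +-comm 1 s ⟩
  s + 1             ≡⟨ cong (s +_) (swallowed-≥ d≤r) ⟨
  s + swallowed d r ≡⟨ law ⟩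
  fromBool b + r    ≤⟨ fromBool+n≤1+n b r ⟩
  suc r             ∎))
  where open ≤-Reasoning
... | inj₂ r<d = m≤n⇒m≤o⊔n r (begin
  s                 ≤⟨ m≤m+n s _ ⟩
  s + swallowed d r ≡⟨ law ⟩
  fromBool b + r    ≤⟨ fromBool+n≤1+n b r ⟩
  suc r             ≤⟨ r<d ⟩
  d                 ∎)
  where open ≤-Reasoning

received≤sent : ∀ {d r s} → Relays d (true , r , s) → r ≤ s
received≤sent {d} {r} {s} law = s≤s⁻¹ (begin
  suc r             ≡⟨ law ⟨
  s + swallowed d r ≤⟨ +-monoʳ-≤ s (swallowed≤1 d r) ⟩
  s + 1             ≡⟨ +-comm s 1 ⟩
  suc s             ∎)
  where open ≤-Reasoning

relays-balanced⇒id≤ : ∀ {d r} → Relays d (true , r , r) → d ≤ r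
relays-balanced⇒id≤ {d} {r} law =
  swallowed≡1⇒≤ (+-cancelˡ-≡ r _ _ (trans law (sym (+-comm r 1))))

markStarted : ∀ {n} → Fin n → Config n → Config n
markStarted i c = config (λ j → if ⌊ i ≟ j ⌋ then true else started c j) (rho c) (sigma c) (inbox c)

consumeCW : ∀ {n} → Fin n → Config n → Config n
consumeCW i c = config (started c) (bump i 1 (rho c)) (sigma c) (drop1 i (inbox c))

Idle : ∀ {n} → Config n → Fin n → Set
Idle c i = started c i ≡ true × inbox c i ≡ 0

data StepView {n} (ID : Fin n → ℕ) (i : Fin n) (c : Config n) : Config n → Set where
  starting : started c i ≡ false → StepView ID i c (sendCW i (markStarted i c))
  idle     : Idle c i → StepView ID i c c
  electing : ∀ {x} → started c i ≡ true → inbox c i ≡ suc x → rho c i + 1 ≡ ID i →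
             StepView ID i c (consumeCW i c)
  relaying : ∀ {x} → started c i ≡ true → inbox c i ≡ suc x → rho c i + 1 ≢ ID i →
             StepView ID i c (sendCW i (consumeCW i c))

stepView : ∀ {n} (ID : Fin n → ℕ) i c → StepView ID i c (step ID i c)
stepView ID i c with started c i in started≡
... | false = starting started≡
... | true with inbox c i in inbox≡
...   | zero = idle (started≡ , inbox≡)
...   | suc _ rewrite bump-updates i 1 (rho c) with rho c i + 1 ≟ℕ ID i
...     | yes elected = electing started≡ inbox≡ elected
...     | no ¬elected = relaying started≡ inbox≡ ¬elected

local-started : ∀ {n} (c : Config n) i {b} → started c i ≡ b → (b , rho c i , sigma c i) ≡ local c i
local-started _ _ started≡ = cong (_, _) (sym started≡)

stepView-local : ∀ {n} {ID : Fin n → ℕ} {i c c'} → StepView ID i c c' →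
  (c' ≡ c × Idle c i) ⊎
  (LocalStep (ID i) (local c i) (local c' i) × (∀ {j} → i ≢ j → local c' j ≡ local c j))
stepView-local (idle idle-i) = inj₁ (refl , idle-i)
stepView-local {i = i} {c} (starting started≡) =
  inj₂ (subst₂ (LocalStep _) (local-started c i started≡) after start , unchanged)
  where
  after : (true , rho c i , sigma c i + 1) ≡ local (sendCW i (markStarted i c)) i
  after = sym (cong₂ (λ b s → b , rho c i , s) (if-≟-refl i) (bump-updates i 1 (sigma c)))
  unchanged : ∀ {j} → i ≢ j → local (sendCW i (markStarted i c)) j ≡ local c j
  unchanged {j} i≢j = cong₂ (λ b s → b , rho c j , s) (if-≟-≢ i≢j) (bump-minimal 1 (sigma c) i≢j)
stepView-local {i = i} {c} (electing started≡ _ elected) =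
  inj₂ (subst₂ (LocalStep _) (local-started c i started≡) after (elect elected) , unchanged)
  where
  after : (true , rho c i + 1 , sigma c i) ≡ local (consumeCW i c) i
  after = sym (cong₂ (λ b r → b , r , sigma c i) started≡ (bump-updates i 1 (rho c)))
  unchanged : ∀ {j} → i ≢ j → local (consumeCW i c) j ≡ local c j
  unchanged {j} i≢j = cong (λ r → started c j , r , sigma c j) (bump-minimal 1 (rho c) i≢j)
stepView-local {i = i} {c} (relaying started≡ _ ¬elected) =
  inj₂ (subst₂ (LocalStep _) (local-started c i started≡) after (relay ¬elected) , unchanged)
  where
  after : (true , rho c i + 1 , sigma c i + 1) ≡ local (sendCW i (consumeCW i c)) i
  after = sym (cong₂ _,_ started≡ (cong₂ _,_ (bump-updates i 1 (rho c)) (bump-updates i 1 (sigma c))))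
  unchanged : ∀ {j} → i ≢ j → local (sendCW i (consumeCW i c)) j ≡ local c j
  unchanged {j} i≢j = cong₂ (λ r s → started c j , r , s)
                            (bump-minimal 1 (rho c) i≢j) (bump-minimal 1 (sigma c) i≢j)

-- The invariant

Conserved : ∀ {n} → Config n → Set
Conserved c = ∀ k → rho c (cwNext k) + inbox c (cwNext k) ≡ sigma c k

sendCW-conserved : ∀ {n} (i : Fin n) c → Conserved c → Conserved (sendCW i c)
sendCW-conserved i c law k with i ≟ k
... | yes refl = begin
  rho c (cwNext i) + bump (cwNext i) 1 (inbox c) (cwNext i)
    ≡⟨ cong (rho c (cwNext i) +_) (bump-updates (cwNext i) 1 (inbox c)) ⟩
  rho c (cwNext i) + (inbox c (cwNext i) + 1)
    ≡⟨ +-assoc (rho c (cwNext i)) _ 1 ⟨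
  rho c (cwNext i) + inbox c (cwNext i) + 1
    ≡⟨ cong (_+ 1) (law i) ⟩
  sigma c i + 1
    ∎
  where open ≡-Reasoning
... | no i≢k = begin
  rho c (cwNext k) + bump (cwNext i) 1 (inbox c) (cwNext k)
    ≡⟨ cong (rho c (cwNext k) +_) (bump-minimal 1 (inbox c) (i≢k ∘ cwNext-injective)) ⟩
  rho c (cwNext k) + inbox c (cwNext k)
    ≡⟨ law k ⟩
  sigma c k
    ∎
  where open ≡-Reasoning

consumeCW-conserved : ∀ {n} (i : Fin n) c {x} → inbox c i ≡ suc x →
  Conserved c → Conserved (consumeCW i c)
-- Splitting on the very test i ≟ cwNext k that bump and drop1 perform makes both compute.
consumeCW-conserved i c {x} inbox≡ law k with i ≟ cwNext k
... | yes refl = begin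
  rho c (cwNext k) + 1 + (inbox c (cwNext k) ∸ 1) ≡⟨ cong (λ y → rho c (cwNext k) + 1 + (y ∸ 1)) inbox≡ ⟩
  rho c (cwNext k) + 1 + x                        ≡⟨ +-assoc (rho c (cwNext k)) 1 x ⟩
  rho c (cwNext k) + suc x                        ≡⟨ cong (rho c (cwNext k) +_) inbox≡ ⟨
  rho c (cwNext k) + inbox c (cwNext k)           ≡⟨ law k ⟩
  sigma c k                                       ∎
  where open ≡-Reasoning
... | no _ = law k

record Invariant {n} (ID : Fin n → ℕ) (c : Config n) : Set where
  field
    relays    : ∀ i → Relays (ID i) (local c i)
    conserves : Conserved c
    bounded   : ∀ i → rho c i ≤ idMax ID
open Invariant

initial-invariant : ∀ {n} (ID : Fin n → ℕ) → (∀ i → 0 < ID i) → Invariant ID initial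
initial-invariant ID ID>0 = record
  { relays    = λ i → swallowed-< (ID>0 i)
  ; conserves = λ _ → refl
  ; bounded   = λ _ → z≤n
  }

sigma-bounded : ∀ {n} {ID : Fin n → ℕ} {c} → Invariant ID c → ∀ i → sigma c i ≤ idMax ID
sigma-bounded {ID = ID} I i =
  ≤-trans (sent≤received⊔id (relays I i)) (⊔-lub (bounded I i) (idMax-upper ID i))

consumeCW-bounded : ∀ {n} {ID : Fin n → ℕ} {c i x} → Invariant ID c → inbox c i ≡ suc x →
  ∀ j → bump i 1 (rho c) j ≤ idMax ID
consumeCW-bounded {ID = ID} {c} {i} {x} I inbox≡ j with i ≟ j
... | no _     = bounded I j
... | yes refl = begin
  rho c i + 1                ≤⟨ +-monoʳ-≤ (rho c i) (s≤s (z≤n {x})) ⟩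
  rho c i + suc x            ≡⟨ cong (rho c i +_) inbox≡ ⟨
  rho c i + inbox c i        ≡⟨ arrived ⟩
  sigma c (cwPrev i)         ≤⟨ sigma-bounded I (cwPrev i) ⟩
  idMax ID                   ∎
  where
  open ≤-Reasoning
  arrived : rho c i + inbox c i ≡ sigma c (cwPrev i)
  arrived = subst (λ j → rho c j + inbox c j ≡ sigma c (cwPrev i)) (cwNext-cwPrev i) (conserves I (cwPrev i))

relays-preserved : ∀ {n} {ID : Fin n → ℕ} {i c c'} → (∀ j → Relays (ID j) (local c j)) →
  StepView ID i c c' → ∀ j → Relays (ID j) (local c' j)
relays-preserved {ID = ID} {i} law v j with stepView-local v
... | inj₁ (refl , _) = law j
... | inj₂ (local-step , unchanged) with i ≟ j
...   | yes refl = relays-step local-step (law i)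
...   | no i≢j   = subst (Relays (ID j)) (sym (unchanged i≢j)) (law j)

invariant-step : ∀ {n} {ID : Fin n → ℕ} {i c c'} → Invariant ID c → StepView ID i c c' → Invariant ID c'
invariant-step {i = i} {c} I v@(starting _) = record
  { relays    = relays-preserved (relays I) v
  ; conserves = sendCW-conserved i (markStarted i c) (conserves I)
  ; bounded   = bounded I
  }
invariant-step I (idle _) = I
invariant-step {i = i} {c} I v@(electing _ inbox≡ _) = record
  { relays    = relays-preserved (relays I) v
  ; conserves = consumeCW-conserved i c inbox≡ (conserves I)
  ; bounded   = consumeCW-bounded I inbox≡
  }
invariant-step {i = i} {c} I v@(relaying _ inbox≡ _) = record
  { relays    = relays-preserved (relays I) v
  ; conserves = sendCW-conserved i (consumeCW i c) (consumeCW-conserved i c inbox≡ (conserves I))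
  ; bounded   = consumeCW-bounded I inbox≡
  }

invariant-run : ∀ {n} (ID : Fin n → ℕ) → (∀ i → 0 < ID i) → ∀ s t → Invariant ID (run ID s t)
invariant-run ID ID>0 s zero    = initial-invariant ID ID>0
invariant-run ID ID>0 s (suc t) = invariant-step (invariant-run ID ID>0 s t) (stepView ID (s t) (run ID s t))

-- Termination

totalEvents : ∀ {n} → Config n → ℕ
totalEvents c = sum (λ j → events (local c j))

totalEvents-step : ∀ {n} {ID : Fin n → ℕ} {i c c'} → StepView ID i c c' →
  (c' ≡ c × Idle c i) ⊎ totalEvents c' ≡ suc (totalEvents c)
totalEvents-step v with stepView-local v
... | inj₁ stays = inj₁ stays
... | inj₂ (local-step , unchanged) =
  inj₂ (sum-suc-at _ _ _ (events-step local-step) (λ j i≢j → cong events (unchanged i≢j)))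

totalEvents-bounded : ∀ {n} {ID : Fin n → ℕ} {c} → Invariant ID c →
  totalEvents c ≤ sum (λ (_ : Fin n) → suc (idMax ID))
totalEvents-bounded I = sum-mono-≤ (λ j → ≤-trans (fromBool+n≤1+n _ _) (s≤s (bounded I j)))

idle? : ∀ {n} (c : Config n) i → Dec (Idle c i)
idle? c i = (started c i ≟ᵇ true) ×-dec (inbox c i ≟ℕ 0)

module _ {n} (ID : Fin n → ℕ) (ID>0 : ∀ i → 0 < ID i) (s : ℕ → Fin n) (fair : Fair s) where

  private
    R : ℕ → Config n
    R = run ID s

    E : ℕ → ℕ
    E t = totalEvents (R t)

  step-grows-or-idles : ∀ t → E t < E (suc t) ⊎ (R (suc t) ≡ R t × Idle (R t) (s t))
  step-grows-or-idles t with totalEvents-step (stepView ID (s t) (R t))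
  ... | inj₁ stays = inj₂ stays
  ... | inj₂ grows = inj₁ (≤-reflexive (sym grows))

  grows-or-stays : ∀ t d → E t < E (t + d) ⊎ R (t + d) ≡ R t
  grows-or-stays t zero = inj₂ (cong R (+-identityʳ t))
  grows-or-stays t (suc d) rewrite +-suc t d with grows-or-stays t d | step-grows-or-idles (t + d)
  ... | inj₁ grew   | inj₁ grows       = inj₁ (<-trans grew grows)
  ... | inj₁ grew   | inj₂ (stays , _) = inj₁ (<-≤-trans grew (≤-reflexive (cong totalEvents (sym stays))))
  ... | inj₂ stayed | inj₁ grows       = inj₁ (≤-<-trans (≤-reflexive (cong totalEvents (sym stayed))) grows)
  ... | inj₂ stayed | inj₂ (stays , _) = inj₂ (trans stays stayed)

  busy⇒grows : ∀ t i → ¬ Idle (R t) i → ∃ λ t' → E t < E t'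
  busy⇒grows t i busy with fair i t
  ... | t' , t≤t' , scheduled with m≤n⇒∃[o]m+o≡n t≤t'
  ...   | d , refl with grows-or-stays t d | step-grows-or-idles (t + d)
  ...     | inj₁ grew   | _                 = t + d , grew
  ...     | inj₂ stayed | inj₁ grows        =
    suc (t + d) , ≤-<-trans (≤-reflexive (cong totalEvents (sym stayed))) grows
  ...     | inj₂ stayed | inj₂ (_ , idle-i) = ⊥-elim (busy (subst₂ Idle stayed scheduled idle-i))

  eventually-idle : ∃ λ t → ∀ i → Idle (R t) i
  eventually-idle = within maxEvents 0 (m≤m+n maxEvents _)
    where
    maxEvents : ℕ
    maxEvents = sum (λ (_ : Fin n) → suc (idMax ID))

    within : ∀ k t → maxEvents ≤ k + E t → ∃ λ t → ∀ i → Idle (R t) i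
    within k t maxEvents≤ with all? (idle? (R t))
    ... | yes all-idle = t , all-idle
    ... | no ¬all-idle with ¬∀⟶∃¬ n _ (idle? (R t)) ¬all-idle
    ...   | i , busy with busy⇒grows t i busy | k
    ...     | t' , grew | zero  =
      ⊥-elim (<⇒≱ (<-≤-trans grew (totalEvents-bounded (invariant-run ID ID>0 s t'))) maxEvents≤)
    ...     | t' , grew | suc k = within k t' (begin
      maxEvents     ≤⟨ maxEvents≤ ⟩
      suc k + E t   ≡⟨ +-suc k _ ⟨
      k + suc (E t) ≤⟨ +-monoʳ-≤ k grew ⟩
      k + E t'      ∎)
      where open ≤-Reasoning

idle⇒saturated : ∀ {m} {ID : Fin (suc m) → ℕ} {c} → Invariant ID c → (∀ i → Idle c i) →
  ∀ i → sigma c i ≡ idMax ID × rho c i ≡ idMax ID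
idle⇒saturated {m} {ID} {c} I idle-everywhere i =
  trans (sigma≡R i) R≡idMax , trans (rho≡R i) R≡idMax
  where
  R : ℕ
  R = rho c zero

  received≡sent : ∀ k → rho c (cwNext k) ≡ sigma c k
  received≡sent k = begin
    rho c (cwNext k)                      ≡⟨ +-identityʳ _ ⟨
    rho c (cwNext k) + 0                  ≡⟨ cong (rho c (cwNext k) +_) (proj₂ (idle-everywhere (cwNext k))) ⟨
    rho c (cwNext k) + inbox c (cwNext k) ≡⟨ conserves I k ⟩
    sigma c k                             ∎
    where open ≡-Reasoning

  relays-started : ∀ k → Relays (ID k) (true , rho c k , sigma c k)
  relays-started k = subst (λ b → Relays (ID k) (b , rho c k , sigma c k)) (proj₁ (idle-everywhere k)) (relays I k)

  rho≡R : ∀ k → rho c k ≡ R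
  rho≡R = cwNext-monotone⇒constant (rho c)
    (λ k → ≤-trans (received≤sent (relays-started k)) (≤-reflexive (sym (received≡sent k))))

  sigma≡R : ∀ k → sigma c k ≡ R
  sigma≡R k = trans (sym (received≡sent k)) (rho≡R (cwNext k))

  ID≤R : ∀ k → ID k ≤ R
  ID≤R k = relays-balanced⇒id≤
    (subst₂ (λ r s → Relays (ID k) (true , r , s)) (rho≡R k) (sigma≡R k) (relays-started k))

  R≡idMax : R ≡ idMax ID
  R≡idMax = ≤-antisym (bounded I zero) (idMax-least ID ID≤R)

corollary3p8 : (n : ℕ) (ID : Fin n → ℕ) → Injective _≡_ _≡_ ID → (∀ i → 0 < ID i)
    → (s : ℕ → Fin n) → Fair s
    → ∃ λ t → (∀ i → sigma (run ID s t) i ≡ idMax ID × rho (run ID s t) i ≡ idMax ID)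
      × Quiescent (run ID s t)
corollary3p8 zero    ID _ ID>0 s fair = 0 , (λ ()) , (λ ())
corollary3p8 (suc m) ID _ ID>0 s fair with eventually-idle ID ID>0 s fair
... | t , idle-everywhere =
  t , idle⇒saturated (invariant-run ID ID>0 s t) idle-everywhere , (λ i → proj₂ (idle-everywhere i))
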